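{- For any matroid $M$ on a finite ground set $E$, the power series $F(M,\mathbf{x})$ is quasisymmetric.
   Context: Let $M$ be a matroid on a finite ground set $E$ with set of bases $\mathcal{B}(M)$, and let $\mathbb{P}=\{1,2,3,\ldots\}$. For $f:E\to\mathbb{P}$ and $B\subseteq E$ write $f(B)=\sum_{e\in B}f(e)$. Call $f$ $M$-generic if the minimum of $f(B)$ over $B\in\mathcal{B}(M)$ is attained by a unique base. Define the formal power series in variables $x_1,x_2,\ldots$ $$F(M,\mathbf{x})=\sum_{f:E\to\mathbb{P}\ \text{$M$-generic}}\ \prod_{e\in E}x_{f(e)}.$$ A power series $g$ in the linearly ordered variables $x_1,x_2,\ldots$ is quasisymmetric if it has bounded degree and, for every composition $(\alpha_1,\ldots,\alpha_k)$ (sequence of positive integers), the coefficient of $x_{i_1}^{\alpha_1}\cdots x_{i_k}^{\alpha_k}$ in $g$ is the same for all $i_1<\cdots<i_k$. -}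

module Defs where

open import Data.Bool using (Bool; true; false; if_then_else_)
open import Data.Nat using (ℕ; zero; suc; _+_; _≤_; _<_; _≤?_)
import Data.Nat as ℕ
open import Data.Nat.Properties using (_≟_)
open import Data.Fin using (Fin; zero; suc; toℕ)
open import Data.Fin.Subset using (Subset; _∈_; _∉_; _∪_; _-_; ⁅_⁆)
open import Data.Fin.Subset.Properties using (anySubset?)
import Data.Fin.Properties as FinP
open import Data.Vec using (lookup)
import Data.Vec.Properties as VecP
import Data.Bool.Properties as BoolP
open import Data.List using (List; []; _∷_; length; filter; map; concatMap; allFin)
open import Data.Nat.ListAction using (sum)
open import Level using (0ℓ)
open import Data.Product using (Σ; ∃; _×_; _,_)
open import Relation.Binary.PropositionalEquality using (_≡_)
open import Relation.Nullary using (Dec; yes; no; ¬_; does)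
open import Relation.Nullary.Decidable using (_×-dec_; _→-dec_; ¬?; decidable-stable)
open import Relation.Unary using (Pred; Decidable)

-- Bases of a matroid on a finite set form a finite family; we record
-- decidability of being a base (needed to count coefficients).

record Matroid (n : ℕ) : Set₁ where
  field
    IsBase      : Subset n → Set
    isBase?     : Decidable IsBase
    base-exists : ∃ λ B → IsBase B
    exchange    : ∀ B₁ B₂ → IsBase B₁ → IsBase B₂ →
                  ∀ x → x ∈ B₁ → x ∉ B₂ →
                  ∃ λ y → y ∈ B₂ × y ∉ B₁ × IsBase ((B₁ - x) ∪ ⁅ y ⁆)

open Matroid public

weight : ∀ {n} → (Fin n → ℕ) → Subset n → ℕ
weight {n} f B = sum (map (λ e → if lookup B e then f e else 0) (allFin n))

Generic : ∀ {n} → Matroid n → (Fin n → ℕ) → Set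
Generic M f =
  ∃ λ B → IsBase M B
        × (∀ B′ → IsBase M B′ → weight f B ≤ weight f B′)
        × (∀ B′ → IsBase M B′ → weight f B′ ≡ weight f B → B′ ≡ B)

Positive : ∀ {n} → (Fin n → ℕ) → Set
Positive f = ∀ e → 1 ≤ f e

allSubset? : ∀ {n} {P : Pred (Subset n) 0ℓ} → Decidable P → Dec (∀ B → P B)
allSubset? P? with anySubset? (λ B → ¬? (P? B))
... | yes (B , ¬p) = no (λ h → ¬p (h B))
... | no h = yes (λ B → decidable-stable (P? B) (λ ¬p → h (B , ¬p)))

_≟ˢ_ : ∀ {n} (A B : Subset n) → Dec (A ≡ B)
_≟ˢ_ = VecP.≡-dec BoolP._≟_

generic? : ∀ {n} (M : Matroid n) (f : Fin n → ℕ) → Dec (Generic M f)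
generic? M f = anySubset? (λ B → isBase? M B
  ×-dec allSubset? (λ B′ → isBase? M B′ →-dec (weight f B ≤? weight f B′))
  ×-dec allSubset? (λ B′ → isBase? M B′ →-dec
                      ((weight f B′ ≟ weight f B) →-dec (B′ ≟ˢ B))))

count : ∀ {A : Set} {P : Pred A 0ℓ} → Decidable P → List A → ℕ
count P? xs = length (filter P? xs)

fcons : ∀ {n N} → Fin N → (Fin n → Fin N) → Fin (suc n) → Fin N
fcons a g zero    = a
fcons a g (suc x) = g x

allFuns : ∀ n N → List (Fin n → Fin N)
allFuns zero    N = (λ ()) ∷ []
allFuns (suc n) N = concatMap (λ g → map (λ a → fcons a g) (allFin N)) (allFuns n N)

-- Monomials in x₁, x₂, … are exponent functions ex : ℕ → ℕ
-- (ex p = exponent of x_p; only p ≥ 1 are variables).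
-- The monomial of f is ∏_e x_{f(e)}, with exponent mult f p = #{e | f e = p}.

mult : ∀ {n} → (Fin n → ℕ) → ℕ → ℕ
mult {n} f p = count (λ e → f e ≟ p) (allFin n)

-- Coefficient of x^ex in F(M, x), for ex supported below N:
-- the number of M-generic f : E → ℙ whose monomial is x^ex.
-- Such f take values < N, so we enumerate g : E → Fin N and set f = toℕ ∘ g.
coeffF : ∀ {n} → Matroid n → (N : ℕ) → (ℕ → ℕ) → ℕ
coeffF {n} M N ex = count
  (λ g → FinP.all? {n} (λ e → 1 ≤? toℕ (g e))
         ×-dec generic? M (λ e → toℕ (g e))
         ×-dec FinP.all? {N} (λ p → mult (λ e → toℕ (g e)) (toℕ p) ≟ ex (toℕ p)))
  (allFuns n N)

-- Quasisymmetry of a power series given by its coefficient function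
-- c N ex = coefficient of x^ex (ex supported below N).

StrictlyIncreasing : ∀ {k} → (Fin k → ℕ) → Set
StrictlyIncreasing i = ∀ l l′ → toℕ l < toℕ l′ → i l < i l′

compMonomial : ∀ {k} → (α : Fin k → ℕ) → (i : Fin k → ℕ) → ℕ → ℕ
compMonomial {k} α i p = sum (map (λ l → if does (i l ≟ p) then α l else 0) (allFin k))

supBound : ∀ {k} → (Fin k → ℕ) → ℕ
supBound {k} i = suc (sum (map i (allFin k)))

degree : (N : ℕ) → (ℕ → ℕ) → ℕ
degree zero    ex = 0
degree (suc N) ex = ex N + degree N ex

IsQuasisymmetric : ((N : ℕ) → (ℕ → ℕ) → ℕ) → Set
IsQuasisymmetric c =
  (∃ λ d → ∀ N (ex : ℕ → ℕ) → (∀ p → N ≤ p → ex p ≡ 0) →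
            ¬ (c N ex ≡ 0) → degree N ex ≤ d)
  ×
  (∀ k (α : Fin k → ℕ) → (∀ l → 1 ≤ α l) →
   ∀ (i j : Fin k → ℕ) → (∀ l → 1 ≤ i l) → (∀ l → 1 ≤ j l) →
   StrictlyIncreasing i → StrictlyIncreasing j →
   c (supBound i) (compMonomial α i) ≡ c (supBound j) (compMonomial α j))

-- Genericity of f depends only on the relative order of its values, because a base B is
-- the unique f-minimal base iff f x < f y for every exchange B - x + y that is again a
-- base. (Given this, any other base B′ becomes strictly lighter by exchanging out the
-- f-largest element of B′ \ B, so descending on weight ends at B.) Hence, for
-- i₁ < ⋯ < i_k, the generic f with monomial x_{i₁}^{α₁} ⋯ x_{i_k}^{α_k} are exactly the
-- composites i ∘ h of the generic h : E → {1, …, k} taking each value l exactly α_l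
-- times, and their number does not depend on i. Every monomial of F has degree |E|.

module Submission where

open import Defs
open import Data.Nat using (ℕ; zero; suc; _+_; _≤_; _<_; z≤n; s≤s; s≤s⁻¹)
open import Data.Nat.Properties
open import Data.Nat.ListAction using (sum)
open import Data.Nat.Induction using (<-wellFounded)
open import Data.Bool using (true; false; if_then_else_)
open import Data.Fin using (Fin; zero; suc; toℕ; fromℕ<; punchIn)
open import Data.Fin.Properties as Fin
  using (any?; toℕ-injective; toℕ-fromℕ<; punchInᵢ≢i; injective⇒≤)
open import Data.Fin.Subset using (Subset; _∈_; _∉_; _⊆_; _∪_; _-_; ⁅_⁆)
open import Data.Fin.Subset.Properties
  using (_∈?_; ⊆-antisym; x∈⁅x⁆; x∈⁅y⁆⇒x≡y; x∈p∪q⁺; x∈p∪q⁻; p⊆p∪q; p─q⊆p; x∈p∧x≢y⇒x∈p-y)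
open import Data.Vec as Vec using (Vec; []; _∷_; lookup; there)
open import Data.Vec.Properties
  using (lookup∘tabulate; tabulate∘lookup; tabulate-cong; ∷-injective; []=⇒lookup; lookup⇒[]=)
open import Data.List as List
  using (List; []; _∷_; _++_; length; filter; map; concatMap; allFin; cartesianProductWith)
open import Data.List.Properties
  using ( filter-≐; filter-accept; filter-reject; filter-some; filter-none; length-filter
        ; length-tabulate; map-tabulate; map-++; map-∘)
open import Data.List.Relation.Unary.All as All using ([])
open import Data.List.Relation.Unary.All.Properties using (all-filter; tabulate⁺)
open import Data.List.Relation.Unary.AllPairs using ([]; _∷_)
open import Data.List.Relation.Unary.Any as Any using (here)
open import Data.List.Relation.Unary.Any.Properties using (lookup-index)
open import Data.List.Relation.Unary.Unique.Propositional using (Unique)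
open import Data.List.Relation.Unary.Unique.Propositional.Properties as Unique
  using (cartesianProductWith⁺; allFin⁺)
open import Data.List.Membership.Propositional using () renaming (_∈_ to _∈ˡ_)
open import Data.List.Membership.Propositional.Properties
  using (∈-filter⁺; ∈-filter⁻; ∈-lookup; ∈-allFin; ∈-cartesianProductWith⁺)
open import Data.List.Extrema.Nat using (argmax; argmax-all; f[xs]≤f[argmax])
open import Data.Product using (∃; _×_; _,_; proj₁; proj₂; swap)
open import Data.Sum using ([_,_]; inj₂)
open import Function using (_∘_; id; flip)
open import Function.Definitions using (Injective)
import Induction.WellFounded as WF
open import Level using (0ℓ)
open import Relation.Binary.Construct.On using (wellFounded)
open import Relation.Binary.Definitions using (_Respects_; tri<; tri≈; tri>)
open import Relation.Binary.PropositionalEquality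
  using (_≡_; _≢_; _≗_; refl; sym; trans; cong; cong₂; subst; subst₂; module ≡-Reasoning)
open import Relation.Nullary using (yes; no; ¬_; does; contradiction)
open import Relation.Nullary.Decidable using (_×-dec_; ¬?; dec-true; dec-false; decidable-stable)
open import Relation.Unary using (Pred; Decidable; _≐_)
open import Algebra.Properties.CommutativeMonoid.Sum +-0-commutativeMonoid
  using (sum-remove; sum-cong-≗; sum-replicate-zero) renaming (sum to ∑)

sum-tabulate : ∀ {n} (t : Fin n → ℕ) → sum (List.tabulate t) ≡ ∑ t
sum-tabulate {zero}  t = refl
sum-tabulate {suc n} t = cong (t zero +_) (sum-tabulate (t ∘ suc))

sum-map-allFin : ∀ {n} (t : Fin n → ℕ) → sum (map t (allFin n)) ≡ ∑ t
sum-map-allFin t = trans (cong sum (map-tabulate id t)) (sum-tabulate t)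

∑-zero : ∀ {n} {t : Fin n → ℕ} → (∀ e → t e ≡ 0) → ∑ t ≡ 0
∑-zero {n} t≗0 = trans (sum-cong-≗ t≗0) (sum-replicate-zero n)

≤-∑ : ∀ {n} (t : Fin n → ℕ) e → t e ≤ ∑ t
≤-∑ {suc n} t e = subst (t e ≤_) (sym (sum-remove {i = e} t)) (m≤m+n _ _)

∑-remove-term : ∀ {n} (t t′ : Fin n → ℕ) e → t′ e ≡ 0 → (∀ d → d ≢ e → t d ≡ t′ d) →
                ∑ t ≡ t e + ∑ t′
∑-remove-term {suc n} t t′ e t′e≡0 agree = begin
  ∑ t                                ≡⟨ sum-remove {i = e} t ⟩
  t e + ∑ (t ∘ punchIn e)            ≡⟨ cong (t e +_) (sum-cong-≗ (λ j → agree _ (punchInᵢ≢i e j))) ⟩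
  t e + ∑ (t′ ∘ punchIn e)           ≡⟨ cong (λ z → t e + (z + ∑ (t′ ∘ punchIn e))) t′e≡0 ⟨
  t e + (t′ e + ∑ (t′ ∘ punchIn e))  ≡⟨ cong (t e +_) (sum-remove {i = e} t′) ⟨
  t e + ∑ t′                         ∎
  where open ≡-Reasoning

∑-single : ∀ {n} (t : Fin n → ℕ) e → (∀ d → d ≢ e → t d ≡ 0) → ∑ t ≡ t e
∑-single {n} t e zero-elsewhere = begin
  ∑ t                      ≡⟨ ∑-remove-term t (λ _ → 0) e refl zero-elsewhere ⟩
  t e + ∑ {n} (λ _ → 0)    ≡⟨ cong (t e +_) (∑-zero {n} (λ _ → refl)) ⟩
  t e + 0                  ≡⟨ +-identityʳ (t e) ⟩
  t e                      ∎
  where open ≡-Reasoning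

restrict : ∀ {n} → (Fin n → ℕ) → Subset n → Fin n → ℕ
restrict f B e = if lookup B e then f e else 0

restrict-∈ : ∀ {n} (f : Fin n → ℕ) {B e} → e ∈ B → restrict f B e ≡ f e
restrict-∈ f e∈B rewrite []=⇒lookup e∈B = refl

restrict-∉ : ∀ {n} (f : Fin n → ℕ) {B e} → e ∉ B → restrict f B e ≡ 0
restrict-∉ f {B} {e} e∉B with lookup B e in eq
... | true  = contradiction (lookup⇒[]= e B eq) e∉B
... | false = refl

restrict-cong : ∀ {n} (f : Fin n → ℕ) {A B e} → (e ∈ A → e ∈ B) → (e ∈ B → e ∈ A) →
                restrict f A e ≡ restrict f B e
restrict-cong f {A} {B} {e} A⇒B B⇒A with e ∈? A
... | yes e∈A = trans (restrict-∈ f e∈A) (sym (restrict-∈ f (A⇒B e∈A)))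
... | no  e∉A = trans (restrict-∉ f e∉A) (sym (restrict-∉ f (e∉A ∘ B⇒A)))

weight-insert : ∀ {n} (f : Fin n → ℕ) {A B e} → e ∈ B → e ∉ A → A ⊆ B →
                (∀ {d} → d ∈ B → d ≢ e → d ∈ A) → weight f B ≡ f e + weight f A
weight-insert f {A} {B} {e} e∈B e∉A A⊆B B⊆A+e = begin
  weight f B                         ≡⟨ sum-map-allFin (restrict f B) ⟩
  ∑ (restrict f B)                   ≡⟨ ∑-remove-term _ _ e (restrict-∉ f e∉A) agree ⟩
  restrict f B e + ∑ (restrict f A)  ≡⟨ cong₂ _+_ (restrict-∈ f e∈B) (sym (sum-map-allFin (restrict f A))) ⟩
  f e + weight f A                   ∎
  where
  open ≡-Reasoning
  agree : ∀ d → d ≢ e → restrict f B d ≡ restrict f A d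
  agree d d≢e = restrict-cong f (λ d∈B → B⊆A+e d∈B d≢e) A⊆B

x∉p-x : ∀ {n} (p : Subset n) x → x ∉ p - x
x∉p-x (_ ∷ p) zero    ()
x∉p-x (_ ∷ p) (suc x) (there x∈p-x) = x∉p-x p x x∈p-x

weight-exchange : ∀ {n} (f : Fin n → ℕ) {B x y} → x ∈ B → y ∉ B →
                  weight f ((B - x) ∪ ⁅ y ⁆) + f x ≡ weight f B + f y
weight-exchange f {B} {x} {y} x∈B y∉B = begin
  weight f ((B - x) ∪ ⁅ y ⁆) + f x  ≡⟨ cong (_+ f x) (weight-insert f y∈B′ y∉B-x (p⊆p∪q ⁅ y ⁆) drop-y) ⟩
  (f y + weight f (B - x)) + f x     ≡⟨ +-comm (f y + _) (f x) ⟩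
  f x + (f y + weight f (B - x))     ≡⟨ cong (f x +_) (+-comm (f y) _) ⟩
  f x + (weight f (B - x) + f y)     ≡⟨ +-assoc (f x) _ (f y) ⟨
  (f x + weight f (B - x)) + f y     ≡⟨ cong (_+ f y) (weight-insert f x∈B x∉B-x (p─q⊆p B ⁅ x ⁆) x∈p∧x≢y⇒x∈p-y) ⟨
  weight f B + f y                   ∎
  where
  open ≡-Reasoning
  y∈B′ : y ∈ (B - x) ∪ ⁅ y ⁆
  y∈B′ = x∈p∪q⁺ (inj₂ (x∈⁅x⁆ y))
  y∉B-x : y ∉ B - x
  y∉B-x = y∉B ∘ p─q⊆p B ⁅ x ⁆
  x∉B-x : x ∉ B - x
  x∉B-x = x∉p-x B x
  drop-y : ∀ {d} → d ∈ (B - x) ∪ ⁅ y ⁆ → d ≢ y → d ∈ B - x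
  drop-y d∈B′ d≢y =
    [ id , (λ d∈⁅y⁆ → contradiction (x∈⁅y⁆⇒x≡y y d∈⁅y⁆) d≢y) ] (x∈p∪q⁻ (B - x) ⁅ y ⁆ d∈B′)

argmax-on : ∀ {n} {P : Pred (Fin n) 0ℓ} → Decidable P → (f : Fin n → ℕ) → ∃ P →
            ∃ λ m → P m × (∀ {z} → P z → f z ≤ f m)
argmax-on {n} P? f (m₀ , Pm₀) =
    argmax f m₀ candidates
  , argmax-all f Pm₀ (all-filter P? (allFin n))
  , λ Pz → All.lookup (f[xs]≤f[argmax] m₀ candidates) (∈-filter⁺ P? (∈-allFin _) Pz)
  where
  candidates : List (Fin n)
  candidates = filter P? (allFin n)

base-difference : ∀ {n} (M : Matroid n) {B B′} → IsBase M B → IsBase M B′ → B′ ≢ B →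
                  ∃ λ m → m ∈ B′ × m ∉ B
base-difference M {B} {B′} B-base B′-base B′≢B with any? (λ m → m ∈? B′ ×-dec ¬? (m ∈? B))
... | yes found = found
... | no  none  = contradiction (⊆-antisym B′⊆B B⊆B′) B′≢B
  where
  B′⊆B : B′ ⊆ B
  B′⊆B {m} m∈B′ = decidable-stable (m ∈? B) (λ m∉B → none (m , m∈B′ , m∉B))
  B⊆B′ : B ⊆ B′
  B⊆B′ {x} x∈B = decidable-stable (x ∈? B′) λ x∉B′ →
    let (z , z∈B′ , z∉B , _) = exchange M B B′ B-base B′-base x x∈B x∉B′ in none (z , z∈B′ , z∉B)

ExchangeMinimal : ∀ {n} → Matroid n → (Fin n → ℕ) → Subset n → Set
ExchangeMinimal M f B = ∀ x y → x ∈ B → y ∉ B → IsBase M ((B - x) ∪ ⁅ y ⁆) → f x < f y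

generic⇒exchangeMinimal : ∀ {n} (M : Matroid n) {f : Fin n → ℕ} (g : Generic M f) →
                          ExchangeMinimal M f (proj₁ g)
generic⇒exchangeMinimal M {f} (B , _ , minimal , unique) x y x∈B y∉B B′-base with f x <? f y
... | yes fx<fy = fx<fy
... | no  fx≮fy = contradiction (subst (y ∈_) B′≡B (x∈p∪q⁺ (inj₂ (x∈⁅x⁆ y)))) y∉B
  where
  B′ : Subset _
  B′ = (B - x) ∪ ⁅ y ⁆
  B′≤B : weight f B′ ≤ weight f B
  B′≤B = +-cancelʳ-≤ (f x) _ _ (begin
    weight f B′ + f x  ≡⟨ weight-exchange f x∈B y∉B ⟩
    weight f B + f y   ≤⟨ +-monoʳ-≤ (weight f B) (≮⇒≥ fx≮fy) ⟩
    weight f B + f x   ∎)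
    where open ≤-Reasoning
  B′≡B : B′ ≡ B
  B′≡B = unique B′ B′-base (≤-antisym B′≤B (minimal B′ B′-base))

module _ {n} (M : Matroid n) (f : Fin n → ℕ) {B}
         (B-base : IsBase M B) (B-min : ExchangeMinimal M f B) where

  -- m is f-largest in B′ \ B, and exchange-minimality of B gives f y < f z ≤ f m.
  lighter-neighbour : ∀ {B′} → IsBase M B′ → B′ ≢ B → ∃ λ B″ → IsBase M B″ × weight f B″ < weight f B′
  lighter-neighbour {B′} B′-base B′≢B
    with argmax-on (λ e → e ∈? B′ ×-dec ¬? (e ∈? B)) f (base-difference M B-base B′-base B′≢B)
  ... | m , (m∈B′ , m∉B) , m-max with exchange M B′ B B′-base B-base m m∈B′ m∉B
  ... | y , y∈B , y∉B′ , B″-base = _ , B″-base , +-cancelʳ-< (f m) _ _ (begin-strict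
    weight f ((B′ - m) ∪ ⁅ y ⁆) + f m  ≡⟨ weight-exchange f m∈B′ y∉B′ ⟩
    weight f B′ + f y                  <⟨ +-monoʳ-< (weight f B′) fy<fm ⟩
    weight f B′ + f m                  ∎)
    where
    open ≤-Reasoning
    fy<fm : f y < f m
    fy<fm with exchange M B B′ B-base B′-base y y∈B y∉B′
    ... | z , z∈B′ , z∉B , B‴-base = <-≤-trans (B-min y z y∈B z∉B B‴-base) (m-max (z∈B′ , z∉B))

  exchangeMinimal⇒strictMinimum : ∀ B′ → IsBase M B′ → B′ ≢ B → weight f B < weight f B′
  exchangeMinimal⇒strictMinimum = WF.All.wfRec (wellFounded (weight f) <-wellFounded) 0ℓ Claim descend
    where
    Claim : Subset n → Set
    Claim B′ = IsBase M B′ → B′ ≢ B → weight f B < weight f B′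
    descend : ∀ B′ → (∀ {B″} → weight f B″ < weight f B′ → Claim B″) → Claim B′
    descend B′ rec B′-base B′≢B with lighter-neighbour B′-base B′≢B
    ... | B″ , B″-base , B″<B′ with B″ ≟ˢ B
    ...   | yes refl = B″<B′
    ...   | no  B″≢B = <-trans (rec B″<B′ B″-base B″≢B) B″<B′

  exchangeMinimal⇒generic : Generic M f
  exchangeMinimal⇒generic = B , B-base , minimal , unique
    where
    minimal : ∀ B′ → IsBase M B′ → weight f B ≤ weight f B′
    minimal B′ B′-base with B′ ≟ˢ B
    ... | yes refl = ≤-refl
    ... | no  B′≢B = <⇒≤ (exchangeMinimal⇒strictMinimum B′ B′-base B′≢B)
    unique : ∀ B′ → IsBase M B′ → weight f B′ ≡ weight f B → B′ ≡ B
    unique B′ B′-base same with B′ ≟ˢ B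
    ... | yes B′≡B = B′≡B
    ... | no  B′≢B = contradiction (sym same) (<⇒≢ (exchangeMinimal⇒strictMinimum B′ B′-base B′≢B))

generic-transfer : ∀ {n} (M : Matroid n) {u v : Fin n → ℕ} → (∀ a b → u a < u b → v a < v b) →
                   Generic M u → Generic M v
generic-transfer M {v = v} u<⇒v< g@(B , B-base , _) = exchangeMinimal⇒generic M v B-base
  λ x y x∈B y∉B B′-base → u<⇒v< x y (generic⇒exchangeMinimal M g x y x∈B y∉B B′-base)

count-≐ : ∀ {A : Set} {P Q : Pred A 0ℓ} (P? : Decidable P) (Q? : Decidable Q) → P ≐ Q →
          ∀ xs → count P? xs ≡ count Q? xs
count-≐ P? Q? P≐Q xs = cong length (filter-≐ P? Q? P≐Q xs)

count-accept : ∀ {A : Set} {P : Pred A 0ℓ} (P? : Decidable P) {x xs} → P x →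
               count P? (x ∷ xs) ≡ suc (count P? xs)
count-accept P? Px = cong length (filter-accept P? Px)

count-reject : ∀ {A : Set} {P : Pred A 0ℓ} (P? : Decidable P) {x xs} → ¬ P x →
               count P? (x ∷ xs) ≡ count P? xs
count-reject P? ¬Px = cong length (filter-reject P? ¬Px)

count-map : ∀ {A B : Set} {P : Pred B 0ℓ} (P? : Decidable P) (f : A → B) xs →
            count P? (map f xs) ≡ count (P? ∘ f) xs
count-map P? f []       = refl
count-map P? f (x ∷ xs) with does (P? (f x))
... | true  = cong suc (count-map P? f xs)
... | false = count-map P? f xs

count≢0⇒∃ : ∀ {A : Set} {P : Pred A 0ℓ} (P? : Decidable P) xs → count P? xs ≢ 0 → ∃ P
count≢0⇒∃ P? []       nonzero = contradiction refl nonzero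
count≢0⇒∃ P? (x ∷ xs) nonzero with P? x
... | yes Px = x , Px
... | no  _  = count≢0⇒∃ P? xs nonzero

unique-lookup-injective : ∀ {A : Set} {xs : List A} → Unique xs → ∀ {i j} →
                          List.lookup xs i ≡ List.lookup xs j → i ≡ j
unique-lookup-injective (_  ∷ _)   {zero}  {zero}  _  = refl
unique-lookup-injective (x∉ ∷ _)   {zero}  {suc j} eq = contradiction eq (All.lookup x∉ (∈-lookup j))
unique-lookup-injective (x∉ ∷ _)   {suc i} {zero}  eq = contradiction eq (All.lookup x∉ (∈-lookup i) ∘ sym)
unique-lookup-injective (_  ∷ xs!) {suc i} {suc j} eq = cong suc (unique-lookup-injective xs! eq)

count-≤-injection : ∀ {A B : Set} {P : Pred A 0ℓ} {Q : Pred B 0ℓ} (P? : Decidable P) (Q? : Decidable Q)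
                    {xs : List A} {ys : List B} → Unique xs → (∀ {b} → Q b → b ∈ˡ ys) →
                    (F : ∀ a → P a → B) → (∀ a p → Q (F a p)) →
                    (∀ {a a′} p p′ → F a p ≡ F a′ p′ → a ≡ a′) →
                    count P? xs ≤ count Q? ys
count-≤-injection {A} {P = P} P? Q? {xs} {ys} xs-unique ys-complete F F-Q F-injective =
  injective⇒≤ position-injective
  where
  selected : List A
  selected = filter P? xs
  P-selected : ∀ j → P (List.lookup selected j)
  P-selected j = proj₂ (∈-filter⁻ P? {xs = xs} (∈-lookup j))
  image∈ : ∀ j → F _ (P-selected j) ∈ˡ filter Q? ys
  image∈ j = ∈-filter⁺ Q? (ys-complete (F-Q _ _)) (F-Q _ _)
  position : Fin (length selected) → Fin (length (filter Q? ys))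
  position j = Any.index (image∈ j)
  position-injective : Injective _≡_ _≡_ position
  position-injective {j} {j′} eq = unique-lookup-injective (Unique.filter⁺ P? xs-unique)
    (F-injective _ _ (trans (lookup-index (image∈ j))
                     (trans (cong (List.lookup (filter Q? ys)) eq) (sym (lookup-index (image∈ j′))))))

-- Unique needs propositional equality, which functions Fin n → Fin N only have up to ≗,
-- so they are counted through their tabulations.
allVecs : ∀ n N → List (Vec (Fin N) n)
allVecs n N = map Vec.tabulate (allFuns n N)

allVecs-suc : ∀ n N → allVecs (suc n) N ≡ cartesianProductWith (flip _∷_) (allVecs n N) (allFin N)
allVecs-suc n N = go (allFuns n N)
  where
  go : ∀ gs → map Vec.tabulate (concatMap (λ g → map (λ a → fcons a g) (allFin N)) gs)
            ≡ cartesianProductWith (flip _∷_) (map Vec.tabulate gs) (allFin N)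
  go []       = refl
  go (g ∷ gs) = trans (map-++ Vec.tabulate (map (λ a → fcons a g) (allFin N)) _)
                      (cong₂ _++_ (sym (map-∘ (allFin N))) (go gs))

allVecs-unique : ∀ n N → Unique (allVecs n N)
allVecs-unique zero    N = [] ∷ []
allVecs-unique (suc n) N rewrite allVecs-suc n N =
  cartesianProductWith⁺ (flip _∷_) (swap ∘ ∷-injective) (allVecs-unique n N) (allFin⁺ N)

∈-allVecs : ∀ n N (v : Vec (Fin N) n) → v ∈ˡ allVecs n N
∈-allVecs zero    N []      = here refl
∈-allVecs (suc n) N (a ∷ v) rewrite allVecs-suc n N =
  ∈-cartesianProductWith⁺ (flip _∷_) (∈-allVecs n N v) (∈-allFin a)

count-allFuns≡count-allVecs : ∀ {n N} {P : Pred (Fin n → Fin N) 0ℓ} (P? : Decidable P) → P Respects _≗_ →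
                              count P? (allFuns n N) ≡ count (P? ∘ lookup) (allVecs n N)
count-allFuns≡count-allVecs {n} {N} {P} P? P-resp = begin
  count P? (allFuns n N)                            ≡⟨ count-≐ P? (P? ∘ lookup ∘ Vec.tabulate) P≐ fs ⟩
  count (P? ∘ lookup ∘ Vec.tabulate) (allFuns n N)  ≡⟨ count-map (P? ∘ lookup) Vec.tabulate fs ⟨
  count (P? ∘ lookup) (allVecs n N)                 ∎
  where
  open ≡-Reasoning
  fs : List (Fin n → Fin N)
  fs = allFuns n N
  P≐ : P ≐ (P ∘ lookup ∘ Vec.tabulate)
  P≐ = (λ {g} → P-resp (sym ∘ lookup∘tabulate g)) , (λ {g} → P-resp (lookup∘tabulate g))

lookup-≗⇒≡ : ∀ {A : Set} {n} {v v′ : Vec A n} → lookup v ≗ lookup v′ → v ≡ v′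
lookup-≗⇒≡ {v = v} {v′} eq =
  trans (sym (tabulate∘lookup v)) (trans (tabulate-cong eq) (tabulate∘lookup v′))

count-allFuns-≤ : ∀ {n N k} {P : Pred (Fin n → Fin N) 0ℓ} {Q : Pred (Fin n → Fin k) 0ℓ}
                  (P? : Decidable P) (Q? : Decidable Q) → P Respects _≗_ → Q Respects _≗_ →
                  (F : ∀ g → P g → Fin n → Fin k) → (∀ g p → Q (F g p)) →
                  (∀ {g g′} p p′ → F g p ≗ F g′ p′ → g ≗ g′) →
                  count P? (allFuns n N) ≤ count Q? (allFuns n k)
count-allFuns-≤ {n} {N} {k} {P} {Q} P? Q? P-resp Q-resp F F-Q F-injective = begin
  count P? (allFuns n N)             ≡⟨ count-allFuns≡count-allVecs P? P-resp ⟩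
  count (P? ∘ lookup) (allVecs n N)  ≤⟨ count-≤-injection (P? ∘ lookup) (Q? ∘ lookup) (allVecs-unique n N)
                                          (λ {w} _ → ∈-allVecs n k w) F′ F′-Q F′-injective ⟩
  count (Q? ∘ lookup) (allVecs n k)  ≡⟨ count-allFuns≡count-allVecs Q? Q-resp ⟨
  count Q? (allFuns n k)             ∎
  where
  open ≤-Reasoning
  F′ : ∀ v → P (lookup v) → Vec (Fin k) n
  F′ v p = Vec.tabulate (F (lookup v) p)
  F′-Q : ∀ v p → Q (lookup (F′ v p))
  F′-Q v p = Q-resp (sym ∘ lookup∘tabulate _) (F-Q _ p)
  F′-injective : ∀ {v v′} p p′ → F′ v p ≡ F′ v′ p′ → v ≡ v′
  F′-injective p p′ eq = lookup-≗⇒≡ (F-injective p p′ λ e →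
    trans (sym (lookup∘tabulate _ e)) (trans (cong (λ w → lookup w e) eq) (lookup∘tabulate _ e)))

count-allFuns-reindex : ∀ {n N k} {P : Pred (Fin n → Fin N) 0ℓ} {Q : Pred (Fin n → Fin k) 0ℓ}
                        (P? : Decidable P) (Q? : Decidable Q) (φ : Fin k → Fin N) → Injective _≡_ _≡_ φ →
                        P Respects _≗_ → (∀ g → P g → ∀ e → ∃ λ l → φ l ≡ g e) →
                        (∀ h → P (φ ∘ h) → Q h) → (∀ h → Q h → P (φ ∘ h)) →
                        count P? (allFuns n N) ≡ count Q? (allFuns n k)
count-allFuns-reindex {n} {k = k} {P} {Q} P? Q? φ φ-injective P-resp factors P⇒Q Q⇒P = ≤-antisym
  (count-allFuns-≤ P? Q? P-resp Q-resp preimage preimage-Q preimage-injective)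
  (count-allFuns-≤ Q? P? Q-resp P-resp (λ h _ → φ ∘ h) Q⇒P (λ _ _ eq → φ-injective ∘ eq))
  where
  Q-resp : Q Respects _≗_
  Q-resp h≗h′ q = P⇒Q _ (P-resp (cong φ ∘ h≗h′) (Q⇒P _ q))
  preimage : ∀ g → P g → Fin n → Fin k
  preimage g p e = proj₁ (factors g p e)
  preimage-Q : ∀ g p → Q (preimage g p)
  preimage-Q g p = P⇒Q _ (P-resp (λ e → sym (proj₂ (factors g p e))) p)
  preimage-injective : ∀ {g g′} p p′ → preimage g p ≗ preimage g′ p′ → g ≗ g′
  preimage-injective {g} {g′} p p′ eq e =
    trans (sym (proj₂ (factors g p e))) (trans (cong φ (eq e)) (proj₂ (factors g′ p′ e)))

mult-resp : ∀ {n} {u v : Fin n → ℕ} {p q} → (∀ {e} → u e ≡ p → v e ≡ q) → (∀ {e} → v e ≡ q → u e ≡ p) →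
            mult u p ≡ mult v q
mult-resp {n} {u} {v} {p} {q} u⇒v v⇒u = count-≐ (λ e → u e ≟ p) (λ e → v e ≟ q) (u⇒v , v⇒u) (allFin n)

mult-cong : ∀ {n} {u v : Fin n → ℕ} → u ≗ v → ∀ p → mult u p ≡ mult v p
mult-cong {u = u} {v} u≗v p = mult-resp {u = u} {v} (λ {e} → trans (sym (u≗v e))) (λ {e} → trans (u≗v e))

mult-attained : ∀ {n} (u : Fin n → ℕ) e → 0 < mult u (u e)
mult-attained u e = filter-some (λ e′ → u e′ ≟ u e) (Any.map (cong u ∘ sym) (∈-allFin e))

mult-unattained : ∀ {n} {u : Fin n → ℕ} {p} → (∀ e → u e ≢ p) → mult u p ≡ 0
mult-unattained {u = u} {p} u≢p = cong length (filter-none (λ e → u e ≟ p) (tabulate⁺ u≢p))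

degree-cong : ∀ N {a b : ℕ → ℕ} → (∀ p → p < N → a p ≡ b p) → degree N a ≡ degree N b
degree-cong zero    a≡b = refl
degree-cong (suc N) a≡b = cong₂ _+_ (a≡b N ≤-refl) (degree-cong N (λ p p<N → a≡b p (m<n⇒m<1+n p<N)))

module _ {A : Set} (u : A → ℕ) (N : ℕ) where

  private
    ≡N? : Decidable (λ x → u x ≡ N)
    ≡N? x = u x ≟ N
    <N? : Decidable (λ x → u x < N)
    <N? x = u x <? N
    <1+N? : Decidable (λ x → u x < suc N)
    <1+N? x = u x <? suc N

  count-≡+count-< : ∀ xs → count ≡N? xs + count <N? xs ≡ count <1+N? xs
  count-≡+count-< [] = refl
  count-≡+count-< (x ∷ xs) with u x ≟ N | u x <? N | u x <? suc N
  ... | yes u≡N | yes u<N | _         = contradiction u<N (<-irrefl u≡N)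
  ... | yes u≡N | no  _   | no  u≮1+N = contradiction (s≤s (≤-reflexive u≡N)) u≮1+N
  ... | no  _   | yes u<N | no  u≮1+N = contradiction (m<n⇒m<1+n u<N) u≮1+N
  ... | no  u≢N | no  u≮N | yes u<1+N = contradiction (≤∧≢⇒< (s≤s⁻¹ u<1+N) u≢N) u≮N
  ... | yes u≡N | no  u≮N | yes u<1+N = begin
    count ≡N? (x ∷ xs) + count <N? (x ∷ xs)  ≡⟨ cong₂ _+_ (count-accept ≡N? u≡N) (count-reject <N? u≮N) ⟩
    suc (count ≡N? xs + count <N? xs)        ≡⟨ cong suc (count-≡+count-< xs) ⟩
    suc (count <1+N? xs)                     ≡⟨ count-accept <1+N? u<1+N ⟨
    count <1+N? (x ∷ xs)                     ∎
    where open ≡-Reasoning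
  ... | no  u≢N | yes u<N | yes u<1+N = begin
    count ≡N? (x ∷ xs) + count <N? (x ∷ xs)  ≡⟨ cong₂ _+_ (count-reject ≡N? u≢N) (count-accept <N? u<N) ⟩
    count ≡N? xs + suc (count <N? xs)        ≡⟨ +-suc _ _ ⟩
    suc (count ≡N? xs + count <N? xs)        ≡⟨ cong suc (count-≡+count-< xs) ⟩
    suc (count <1+N? xs)                     ≡⟨ count-accept <1+N? u<1+N ⟨
    count <1+N? (x ∷ xs)                     ∎
    where open ≡-Reasoning
  ... | no  u≢N | no  u≮N | no  u≮1+N = begin
    count ≡N? (x ∷ xs) + count <N? (x ∷ xs)  ≡⟨ cong₂ _+_ (count-reject ≡N? u≢N) (count-reject <N? u≮N) ⟩
    count ≡N? xs + count <N? xs              ≡⟨ count-≡+count-< xs ⟩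
    count <1+N? xs                           ≡⟨ count-reject <1+N? u≮1+N ⟨
    count <1+N? (x ∷ xs)                     ∎
    where open ≡-Reasoning

degree-count≤ : ∀ {A : Set} (u : A → ℕ) N xs →
                degree N (λ p → count (λ x → u x ≟ p) xs) ≤ count (λ x → u x <? N) xs
degree-count≤ u zero    xs = z≤n
degree-count≤ u (suc N) xs =
  ≤-trans (+-monoʳ-≤ _ (degree-count≤ u N xs)) (≤-reflexive (count-≡+count-< u N xs))

degree-mult≤ : ∀ {n} N (u : Fin n → ℕ) → degree N (mult u) ≤ n
degree-mult≤ {n} N u = begin
  degree N (mult u)                        ≤⟨ degree-count≤ u N (allFin n) ⟩
  count (λ e → u e <? N) (allFin n)        ≤⟨ length-filter (λ e → u e <? N) (allFin n) ⟩
  length (allFin n)                        ≡⟨ length-tabulate id ⟩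
  n                                        ∎
  where open ≤-Reasoning

strictlyIncreasing⇒injective : ∀ {k} {i : Fin k → ℕ} → StrictlyIncreasing i → Injective _≡_ _≡_ i
strictlyIncreasing⇒injective {i = i} i-inc {l} {l′} eq with Fin.<-cmp l l′
... | tri< l<l′ _ _ = contradiction eq (<⇒≢ (i-inc l l′ l<l′))
... | tri≈ _ l≡l′ _ = l≡l′
... | tri> _ _ l′<l = contradiction (sym eq) (<⇒≢ (i-inc l′ l l′<l))

strictlyIncreasing-reflects-< : ∀ {k} {i : Fin k → ℕ} → StrictlyIncreasing i →
                                ∀ {l l′} → i l < i l′ → toℕ l < toℕ l′
strictlyIncreasing-reflects-< {i = i} i-inc {l} {l′} il<il′ with Fin.<-cmp l l′
... | tri< l<l′ _ _ = l<l′
... | tri≈ _ refl _ = contradiction il<il′ (<-irrefl refl)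
... | tri> _ _ l′<l = contradiction il<il′ (<-asym (i-inc l′ l l′<l))

module _ {k} (α : Fin k → ℕ) (i : Fin k → ℕ) where

  private
    term : ℕ → Fin k → ℕ
    term p l = if does (i l ≟ p) then α l else 0

  compMonomial-at : Injective _≡_ _≡_ i → ∀ l → compMonomial α i (i l) ≡ α l
  compMonomial-at i-injective l = begin
    compMonomial α i (i l)  ≡⟨ sum-map-allFin (term (i l)) ⟩
    ∑ (term (i l))          ≡⟨ ∑-single (term (i l)) l other-terms ⟩
    term (i l) l            ≡⟨ cong (if_then α l else 0) (dec-true (i l ≟ i l) refl) ⟩
    α l                     ∎
    where
    open ≡-Reasoning
    other-terms : ∀ l′ → l′ ≢ l → term (i l) l′ ≡ 0
    other-terms l′ l′≢l = cong (if_then α l′ else 0) (dec-false (i l′ ≟ i l) (l′≢l ∘ i-injective))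

  compMonomial-outside : ∀ {p} → (∀ l → i l ≢ p) → compMonomial α i p ≡ 0
  compMonomial-outside {p} i≢p = trans (sum-map-allFin (term p))
    (∑-zero λ l → cong (if_then α l else 0) (dec-false (i l ≟ p) (i≢p l)))

Contributes : ∀ {n} → Matroid n → (N : ℕ) → (ℕ → ℕ) → (Fin n → Fin N) → Set
Contributes M N ex g =
  Positive (toℕ ∘ g) × Generic M (toℕ ∘ g) × (∀ (p : Fin N) → mult (toℕ ∘ g) (toℕ p) ≡ ex (toℕ p))

contributes? : ∀ {n} (M : Matroid n) N ex → Decidable (Contributes M N ex)
contributes? {n} M N ex g = Fin.all? {n} (λ e → 1 ≤? toℕ (g e))
                      ×-dec generic? M (toℕ ∘ g)
                      ×-dec Fin.all? {N} (λ p → mult (toℕ ∘ g) (toℕ p) ≟ ex (toℕ p))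

contributes-resp-≗ : ∀ {n} (M : Matroid n) {N} ex → Contributes M N ex Respects _≗_
contributes-resp-≗ M ex g≗g′ (positive , generic , monomial) =
    (λ e → subst (λ a → 1 ≤ toℕ a) (g≗g′ e) (positive e))
  , generic-transfer M (λ a b → subst₂ _<_ (cong toℕ (g≗g′ a)) (cong toℕ (g≗g′ b))) generic
  , λ p → trans (sym (mult-cong (cong toℕ ∘ g≗g′) (toℕ p))) (monomial p)

degree-bounded : ∀ {n} (M : Matroid n) N ex → coeffF M N ex ≢ 0 → degree N ex ≤ n
degree-bounded {n} M N ex nonzero with count≢0⇒∃ (contributes? M N ex) (allFuns n N) nonzero
... | g , _ , _ , monomial = ≤-trans (≤-reflexive (degree-cong N ex≡mult)) (degree-mult≤ N (toℕ ∘ g))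
  where
  ex≡mult : ∀ p → p < N → ex p ≡ mult (toℕ ∘ g) p
  ex≡mult p p<N = subst (λ q → ex q ≡ mult (toℕ ∘ g) q) (toℕ-fromℕ< p<N) (sym (monomial (fromℕ< p<N)))

GenericWithContent : ∀ {n} → Matroid n → ∀ {k} → (Fin k → ℕ) → (Fin n → Fin k) → Set
GenericWithContent M α h = Generic M (toℕ ∘ h) × (∀ l → mult (toℕ ∘ h) (toℕ l) ≡ α l)

genericWithContent? : ∀ {n} (M : Matroid n) {k} (α : Fin k → ℕ) → Decidable (GenericWithContent M α)
genericWithContent? M α h = generic? M (toℕ ∘ h) ×-dec Fin.all? (λ l → mult (toℕ ∘ h) (toℕ l) ≟ α l)

module _ {n} (M : Matroid n) {k} (α : Fin k → ℕ) {i : Fin k → ℕ}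
         (i-positive : ∀ l → 1 ≤ i l) (i-increasing : StrictlyIncreasing i) where

  private
    N : ℕ
    N = supBound i

    i<N : ∀ l → i l < N
    i<N l = s≤s (subst (i l ≤_) (sym (sum-map-allFin i)) (≤-∑ i l))

    ι : Fin k → Fin N
    ι l = fromℕ< (i<N l)

    toℕ-ι : ∀ l → toℕ (ι l) ≡ i l
    toℕ-ι l = toℕ-fromℕ< (i<N l)

    i-injective : Injective _≡_ _≡_ i
    i-injective = strictlyIncreasing⇒injective i-increasing

    ι-injective : Injective _≡_ _≡_ ι
    ι-injective eq = i-injective (trans (sym (toℕ-ι _)) (trans (cong toℕ eq) (toℕ-ι _)))

    mult-ι : ∀ (h : Fin n → Fin k) l → mult (toℕ ∘ ι ∘ h) (toℕ (ι l)) ≡ mult (toℕ ∘ h) (toℕ l)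
    mult-ι h l = mult-resp {u = toℕ ∘ ι ∘ h} {toℕ ∘ h}
      (cong toℕ ∘ ι-injective ∘ toℕ-injective) (cong (toℕ ∘ ι) ∘ toℕ-injective)

    compMonomial-ι : ∀ l → compMonomial α i (toℕ (ι l)) ≡ α l
    compMonomial-ι l = trans (cong (compMonomial α i) (toℕ-ι l)) (compMonomial-at α i i-injective l)

    contributes⇒factors : ∀ g → Contributes M N (compMonomial α i) g → ∀ e → ∃ λ l → ι l ≡ g e
    contributes⇒factors g (_ , _ , monomial) e with any? (λ l → i l ≟ toℕ (g e))
    ... | yes (l , il≡ge) = l , toℕ-injective (trans (toℕ-ι l) il≡ge)
    ... | no  unattained  = contradiction
      (subst (0 <_) (trans (monomial (g e)) (compMonomial-outside α i (λ l il≡ge → unattained (l , il≡ge))))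
             (mult-attained (toℕ ∘ g) e))
      n≮0

    contributes⇒content : ∀ h → Contributes M N (compMonomial α i) (ι ∘ h) → GenericWithContent M α h
    contributes⇒content h (_ , generic , monomial) =
        generic-transfer M (λ a b ιa<ιb → strictlyIncreasing-reflects-< i-increasing
                                             (subst₂ _<_ (toℕ-ι (h a)) (toℕ-ι (h b)) ιa<ιb)) generic
      , λ l → trans (sym (mult-ι h l)) (trans (monomial (ι l)) (compMonomial-ι l))

    content⇒contributes : ∀ h → GenericWithContent M α h → Contributes M N (compMonomial α i) (ι ∘ h)
    content⇒contributes h (generic , content) =
        (λ e → subst (1 ≤_) (sym (toℕ-ι (h e))) (i-positive (h e)))
      , generic-transfer M (λ a b ha<hb → subst₂ _<_ (sym (toℕ-ι (h a))) (sym (toℕ-ι (h b)))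
                                             (i-increasing (h a) (h b) ha<hb)) generic
      , monomial
      where
      monomial : ∀ p → mult (toℕ ∘ ι ∘ h) (toℕ p) ≡ compMonomial α i (toℕ p)
      monomial p with any? (λ l → ι l Fin.≟ p)
      ... | yes (l , refl) = trans (mult-ι h l) (trans (content l) (sym (compMonomial-ι l)))
      ... | no  outside    = trans (mult-unattained (λ e ιhe≡p → outside (h e , toℕ-injective ιhe≡p)))
          (sym (compMonomial-outside α i (λ l il≡p → outside (l , toℕ-injective (trans (toℕ-ι l) il≡p)))))

  coeffF-compMonomial : coeffF M (supBound i) (compMonomial α i)
                      ≡ count (genericWithContent? M α) (allFuns n k)
  coeffF-compMonomial =
    count-allFuns-reindex (contributes? M N (compMonomial α i)) (genericWithContent? M α) ι ι-injective
      (contributes-resp-≗ M (compMonomial α i)) contributes⇒factors contributes⇒content content⇒contributes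

proposition2p1 : ∀ (n : ℕ) (M : Matroid n) → IsQuasisymmetric (coeffF M)
proposition2p1 n M =
    (n , λ N ex _ → degree-bounded M N ex)
  , λ k α _ i j i-positive j-positive i-increasing j-increasing →
      trans (coeffF-compMonomial M α i-positive i-increasing)
            (sym (coeffF-compMonomial M α j-positive j-increasing))
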